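{- Let $r\geq 8$, $0<\varepsilon\leq 1/36$, let $n$ be a positive integer, and let $A\subseteq[n]$ with $|A|=\lceil n/2\rceil+c$ where $1<c\leq\varepsilon n$. Suppose $A=B\cup C$ is a partition such that $B$ consists of odd numbers and $|C|\leq\varepsilon n$. Then $g(A,r)<r^{\lceil n/2\rceil}(3-2/r)$.
   Context: An $r$-coloring of $A$ is a map $A\to[r]$; a rainbow sum is a triple of distinct $x,y,z$ with $x+y=z$ colored with three different colors; a coloring is rainbow sum-free if it has no rainbow sum. $g(A,r)$ is the number of rainbow sum-free $r$-colorings of $A$. -}

module Defs where

open import Data.Nat using (ℕ; zero; suc; _+_; _%_)
open import Data.Fin using (Fin)
open import Data.Fin.Properties using (any?) renaming (_≟_ to _≟ᶠ_)
open import Data.Nat.Properties using () renaming (_≟_ to _≟ℕ_)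
open import Data.List using (List; []; _∷_; length; lookup; concatMap; map; filter)
open import Data.List.Base using (allFin)
open import Data.Vec.Functional using () renaming ([] to []ᵛ; _∷_ to _∷ᵛ_)
open import Data.Product using (_×_; ∃; ∃-syntax; _,_)
open import Data.Product.Properties using ()
open import Relation.Nullary using (¬_; Dec; yes; no)
open import Relation.Nullary.Decidable using (_×-dec_; ¬?)
open import Relation.Binary.PropositionalEquality using (_≡_; _≢_)

-- A finite set A ⊆ ℕ is represented by a duplicate-free list of its elements.
-- An r-colouring of A assigns to each position of the list a colour in Fin r
-- (i.e. a map A → [r]).
Colouring : List ℕ → ℕ → Set
Colouring A r = Fin (length A) → Fin r

RainbowSum : (A : List ℕ) (r : ℕ) → Colouring A r → Set
RainbowSum A r χ =
  ∃[ i ] ∃[ j ] ∃[ k ]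
    ((i ≢ j) × (j ≢ k) × (i ≢ k)) ×
    (lookup A i + lookup A j ≡ lookup A k) ×
    ((χ i ≢ χ j) × (χ j ≢ χ k) × (χ i ≢ χ k))

RainbowSumFree : (A : List ℕ) (r : ℕ) → Colouring A r → Set
RainbowSumFree A r χ = ¬ RainbowSum A r χ

private
  ≢? : ∀ {m} (a b : Fin m) → Dec (a ≢ b)
  ≢? a b = ¬? (a ≟ᶠ b)

rainbowSum? : (A : List ℕ) (r : ℕ) (χ : Colouring A r) → Dec (RainbowSum A r χ)
rainbowSum? A r χ =
  any? λ i → any? λ j → any? λ k →
    (≢? i j ×-dec ≢? j k ×-dec ≢? i k) ×-dec
    (lookup A i + lookup A j ≟ℕ lookup A k) ×-dec
    (≢? (χ i) (χ j) ×-dec ≢? (χ j) (χ k) ×-dec ≢? (χ i) (χ k))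

allMaps : (m r : ℕ) → List (Fin m → Fin r)
allMaps zero    r = []ᵛ ∷ []
allMaps (suc m) r = concatMap (λ c → map (c ∷ᵛ_) (allMaps m r)) (allFin r)

g : List ℕ → ℕ → ℕ
g A r = length (filter (λ χ → ¬? (rainbowSum? A r χ)) (allMaps (length A) r))

Odd : ℕ → Set
Odd m = m % 2 ≡ 1

-- Since |A| > ⌈n/2⌉, the number of odd integers in [n], A contains an even e.  There are
-- |C| + c + 1 disjoint pairs {x, y} of odd integers in [n] with x + y = e (when e is large)
-- or y − x = e (when e is small).  A pair with an element outside A yields a missing odd
-- integer; these together with B are distinct odd integers in [n], so at most |C| − c pairs
-- are lost and 2c + 1 of them lie inside A.  In a rainbow-sum-free colouring the colours of
-- e, x, y are never pairwise distinct: once e is coloured, each pair can be coloured in at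
-- most 3r − 2 ways (r ways when x gets the colour of e, two for each other colour of x).
-- Hence g(A, r) ≤ r^(|A| − 4c − 2) (3r − 2)^(2c+1), and (3r − 2)² ≤ r³ for r ≥ 8 turns
-- this into r g(A, r) ≤ r^(⌈n/2⌉ − 1) (3r − 2).
module Submission where

open import Defs
open import Data.Nat
  using (ℕ; zero; suc; _+_; _*_; _∸_; _^_; _≤_; _<_; z≤n; s≤s; _%_; ⌈_/2⌉; NonZero; >-nonZero; _≟_; _≤?_)
  renaming (_/_ to _div_)
open import Data.Nat.Properties
open import Algebra.Properties.Semiring.Sum +-*-semiring
  using (sum; sum-syntax; sum-cong-≗; ∑-comm; ∑-distrib-+; *-distribˡ-sum; sum-remove)
open import Data.Nat.DivMod using (m≡m%n+[m/n]*n; m%n<n; m/n*n≤m; m<n*o⇒m/o<n; /-monoˡ-≤; [m+kn]%n≡m%n)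
open import Data.Nat.Coprimality using (1-coprimeTo) renaming (sym to coprime-sym)
open import Data.Nat.Tactic.RingSolver using (solve-∀)
open import Data.Integer using (+_)
import Data.Integer as ℤ
import Data.Integer.Properties as ℤ
open import Data.Rational using (ℚ; 0ℚ; _/_; mkℚ; toℚᵘ)
  renaming (_≤_ to _≤ℚ_; _<_ to _<ℚ_; _*_ to _*ℚ_)
import Data.Rational.Properties as ℚ
import Data.Rational.Unnormalised as ℚᵘ
import Data.Rational.Unnormalised.Properties as ℚᵘ
open import Data.Fin using (Fin; zero; suc; punchIn; punchOut; fromℕ<)
open import Data.Fin.Properties
  using (any?; injective⇒≤; fromℕ<-injective; punchIn-punchOut; punchInᵢ≢i; punchIn-injective)
  renaming (_≟_ to _≟ᶠ_)
open import Data.Vec.Functional using (insertAt) renaming ([] to []ᵛ; _∷_ to _∷ᵛ_)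
open import Data.Vec.Functional.Properties using (insertAt-lookup; insertAt-punchIn)
open import Data.List using (List; []; _∷_; length; lookup; map; filter; concatMap; tabulate; applyUpTo; take; _++_)
open import Data.List.Properties
  using (length-++; length-map; length-take; length-applyUpTo; filter-++; filter-accept; filter-reject)
open import Data.List.Relation.Unary.All as All using (All; []; _∷_)
import Data.List.Relation.Unary.All.Properties as All
open import Data.List.Relation.Unary.AllPairs using (AllPairs; []; _∷_)
import Data.List.Relation.Unary.AllPairs.Properties as AllPairs
open import Data.List.Relation.Unary.Any using (index)
open import Data.List.Relation.Unary.Any.Properties using (lookup-index)
open import Data.List.Relation.Unary.Unique.Propositional using (Unique)
import Data.List.Relation.Unary.Unique.Propositional.Properties as Unique
open import Data.List.Relation.Binary.Disjoint.Propositional using (Disjoint)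
open import Data.List.Relation.Binary.Sublist.Propositional using (_⊆_; []; _∷_; _∷ʳ_; ⊆-refl; ⊆-trans)
open import Data.List.Relation.Binary.Sublist.Propositional.Properties using (All-resp-⊆; filter-⊆; take-⊆; ++⁺ʳ)
open import Data.List.Relation.Binary.Permutation.Propositional using (_↭_; ↭-sym; ↭⇒↭ₛ)
open import Data.List.Relation.Binary.Permutation.Propositional.Properties using (↭-length; ∈-resp-↭)
import Data.List.Relation.Binary.Permutation.Setoid.Properties as Permutationₛ
open import Data.List.Membership.DecPropositional _≟_ using (_∈_; _∉_; _∈?_; _∉?_; find)
open import Data.List.Membership.Propositional.Properties using (∈-lookup; ∈-++⁺ˡ)
open import Data.Product using (_×_; ∃-syntax; _,_; proj₁; proj₂)
open import Data.Sum using (_⊎_; inj₁; inj₂)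
open import Data.Empty using (⊥-elim)
open import Function using (_∘_; _∘′_; _$_)
open import Function.Definitions using (Injective)
open import Relation.Nullary using (Dec; yes; no; ¬_)
open import Relation.Nullary.Decidable using (_×-dec_; ¬?)
open import Relation.Unary using (Decidable)
open import Relation.Binary.Definitions using (tri<; tri≈; tri>)
open import Relation.Binary.PropositionalEquality

indicator : ∀ {p} {P : Set p} → Dec P → ℕ
indicator (yes _) = 1
indicator (no _)  = 0

sum-mono-≤ : ∀ {n} {f g : Fin n → ℕ} → (∀ i → f i ≤ g i) → sum f ≤ sum g
sum-mono-≤ {zero}  f≤g = z≤n
sum-mono-≤ {suc n} f≤g = +-mono-≤ (f≤g zero) (sum-mono-≤ (f≤g ∘ suc))

sum-const : ∀ n x → ∑[ i < n ] x ≡ n * x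
sum-const zero    x = refl
sum-const (suc n) x = cong (λ s → x + s) (sum-const n x)

*-distribʳ-sum : ∀ {n} x (f : Fin n → ℕ) → sum f * x ≡ ∑[ i < n ] (f i * x)
*-distribʳ-sum x f = trans (*-comm _ x) (trans (*-distribˡ-sum x f) (sum-cong-≗ (λ i → *-comm x (f i))))

≗-insertAt : ∀ {a} {A : Set a} {n} (h : Fin (suc n) → A) k (f : Fin n → A) c →
             h k ≡ c → (∀ j → h (punchIn k j) ≡ f j) → h ≗ insertAt f k c
≗-insertAt {n = n} h k f c hk≡c h∘punchIn≗f i with i ≟ᶠ k
... | yes refl = trans hk≡c (sym (insertAt-lookup f k c))
... | no i≢k = begin
    h i                          ≡⟨ cong h (sym (punchIn-punchOut k≢i)) ⟩
    h (punchIn k j)              ≡⟨ h∘punchIn≗f j ⟩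
    f j                          ≡⟨ sym (insertAt-punchIn f k c j) ⟩
    insertAt f k c (punchIn k j) ≡⟨ cong (insertAt f k c) (punchIn-punchOut k≢i) ⟩
    insertAt f k c i             ∎
  where
  open ≡-Reasoning
  k≢i : k ≢ i
  k≢i = i≢k ∘ sym
  j : Fin n
  j = punchOut k≢i

insertAt-cong : ∀ {a} {A : Set a} {n} {f g : Fin n → A} {k c} → f ≗ g → insertAt f k c ≗ insertAt g k c
insertAt-cong {f = f} {g} {k} {c} f≗g =
  ≗-insertAt (insertAt f k c) k g c (insertAt-lookup f k c) (λ j → trans (insertAt-punchIn f k c j) (f≗g j))

module _ {a p} {A : Set a} {P : A → Set p} (P? : Decidable P) where

  length-filter-map : ∀ {b} {B : Set b} (h : B → A) xs →
                      length (filter P? (map h xs)) ≡ length (filter (P? ∘ h) xs)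
  length-filter-map h []       = refl
  length-filter-map h (x ∷ xs) with P? (h x)
  ... | yes _ = cong suc (length-filter-map h xs)
  ... | no _  = length-filter-map h xs

  length-filter-concatMap-tabulate : ∀ {b} {B : Set b} (F : B → List A) {k} (f : Fin k → B) →
    length (filter P? (concatMap F (tabulate f))) ≡ ∑[ i < k ] length (filter P? (F (f i)))
  length-filter-concatMap-tabulate F {zero}  f = refl
  length-filter-concatMap-tabulate F {suc k} f = begin
      length (filter P? (F (f zero) ++ concatMap F (tabulate (f ∘ suc))))
    ≡⟨ cong length (filter-++ P? (F (f zero)) _) ⟩
      length (filter P? (F (f zero)) ++ filter P? (concatMap F (tabulate (f ∘ suc))))
    ≡⟨ length-++ (filter P? (F (f zero))) ⟩
      length (filter P? (F (f zero))) + length (filter P? (concatMap F (tabulate (f ∘ suc))))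
    ≡⟨ cong (λ l → length (filter P? (F (f zero))) + l) (length-filter-concatMap-tabulate F (f ∘ suc)) ⟩
      ∑[ i < suc k ] length (filter P? (F (f i)))
    ∎
    where open ≡-Reasoning

Extensional : ∀ {m r} → ((Fin m → Fin r) → ℕ) → Set
Extensional w = ∀ {f g} → f ≗ g → w f ≡ w g

module MapSums (r : ℕ) where

  sumMaps : ∀ m → ((Fin m → Fin r) → ℕ) → ℕ
  sumMaps zero    w = w []ᵛ
  sumMaps (suc m) w = ∑[ c < r ] sumMaps m (λ f → w (c ∷ᵛ f))

  sumMaps-cong : ∀ m {v w : (Fin m → Fin r) → ℕ} → (∀ f → v f ≡ w f) → sumMaps m v ≡ sumMaps m w
  sumMaps-cong zero    v≗w = v≗w []ᵛ
  sumMaps-cong (suc m) v≗w = sum-cong-≗ {r} (λ c → sumMaps-cong m (λ f → v≗w (c ∷ᵛ f)))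

  sumMaps-mono-≤ : ∀ m {v w : (Fin m → Fin r) → ℕ} → (∀ f → v f ≤ w f) → sumMaps m v ≤ sumMaps m w
  sumMaps-mono-≤ zero    v≤w = v≤w []ᵛ
  sumMaps-mono-≤ (suc m) v≤w = sum-mono-≤ (λ c → sumMaps-mono-≤ m (λ f → v≤w (c ∷ᵛ f)))

  *-distribˡ-sumMaps : ∀ m x (w : (Fin m → Fin r) → ℕ) → x * sumMaps m w ≡ sumMaps m (λ f → x * w f)
  *-distribˡ-sumMaps zero    x w = refl
  *-distribˡ-sumMaps (suc m) x w =
    trans (*-distribˡ-sum x (λ c → sumMaps m (λ f → w (c ∷ᵛ f))))
          (sum-cong-≗ {r} (λ c → *-distribˡ-sumMaps m x (λ f → w (c ∷ᵛ f))))

  length-filter-allMaps : ∀ m {p} {P : (Fin m → Fin r) → Set p} (P? : Decidable P) →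
                          length (filter P? (allMaps m r)) ≡ sumMaps m (indicator ∘ P?)
  length-filter-allMaps zero P? with P? []ᵛ
  ... | yes _ = refl
  ... | no _  = refl
  length-filter-allMaps (suc m) P? = begin
      length (filter P? (concatMap (λ c → map (c ∷ᵛ_) (allMaps m r)) (tabulate (λ c → c))))
    ≡⟨ length-filter-concatMap-tabulate P? (λ c → map (c ∷ᵛ_) (allMaps m r)) (λ c → c) ⟩
      ∑[ c < r ] length (filter P? (map (c ∷ᵛ_) (allMaps m r)))
    ≡⟨ sum-cong-≗ {r} (λ c → trans (length-filter-map P? (c ∷ᵛ_) (allMaps m r))
                               (length-filter-allMaps m (P? ∘ (c ∷ᵛ_)))) ⟩
      sumMaps (suc m) (indicator ∘ P?)
    ∎
    where open ≡-Reasoning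

  sumMaps-insertAt : ∀ s (w : (Fin (suc s) → Fin r) → ℕ) → Extensional w → (k : Fin (suc s)) →
                     sumMaps (suc s) w ≡ ∑[ c < r ] sumMaps s (λ f → w (insertAt f k c))
  sumMaps-insertAt s w ext zero = sum-cong-≗ {r} (λ c → sumMaps-cong s (λ f → ext (insertAt-zero c f)))
    where
    insertAt-zero : ∀ c (f : Fin s → Fin r) → (c ∷ᵛ f) ≗ insertAt f zero c
    insertAt-zero c f zero    = refl
    insertAt-zero c f (suc i) = refl
  sumMaps-insertAt (suc s) w ext (suc k) = begin
      ∑[ a < r ] sumMaps (suc s) (λ f → w (a ∷ᵛ f))
    ≡⟨ sum-cong-≗ (λ a → sumMaps-insertAt s (λ f → w (a ∷ᵛ f)) (ext ∘ ∷-cong a) k) ⟩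
      ∑[ a < r ] ∑[ c < r ] sumMaps s (λ f → w (a ∷ᵛ insertAt f k c))
    ≡⟨ ∑-comm (λ a c → sumMaps s (λ f → w (a ∷ᵛ insertAt f k c))) ⟩
      ∑[ c < r ] ∑[ a < r ] sumMaps s (λ f → w (a ∷ᵛ insertAt f k c))
    ≡⟨ sum-cong-≗ {r} (λ c → sum-cong-≗ (λ a → sumMaps-cong s (λ f → ext (insertAt-∷ a f c)))) ⟩
      ∑[ c < r ] sumMaps (suc s) (λ f → w (insertAt f (suc k) c))
    ∎
    where
    open ≡-Reasoning
    ∷-cong : ∀ a {f g : Fin (suc s) → Fin r} → f ≗ g → (a ∷ᵛ f) ≗ (a ∷ᵛ g)
    ∷-cong a f≗g zero    = refl
    ∷-cong a f≗g (suc i) = f≗g i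
    insertAt-∷ : ∀ a (f : Fin s → Fin r) c → (a ∷ᵛ insertAt f k c) ≗ insertAt (a ∷ᵛ f) (suc k) c
    insertAt-∷ a f c zero    = refl
    insertAt-∷ a f c (suc i) = refl

  private
    dropZero : ∀ {s m} (ι : Fin s → Fin (suc m)) → (∀ k → zero ≢ ι k) → Fin s → Fin m
    dropZero ι avoid k = punchOut (avoid k)

    suc-dropZero : ∀ {s m} (ι : Fin s → Fin (suc m)) avoid k → suc (dropZero ι avoid k) ≡ ι k
    suc-dropZero ι avoid k = punchIn-punchOut (avoid k)

    dropZero-injective : ∀ {s m} (ι : Fin s → Fin (suc m)) avoid →
                         Injective _≡_ _≡_ ι → Injective _≡_ _≡_ (dropZero ι avoid)
    dropZero-injective ι avoid ι-inj {x} {y} e =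
      ι-inj (trans (sym (suc-dropZero ι avoid x)) (trans (cong suc e) (suc-dropZero ι avoid y)))

  sumMaps-∘-injective : ∀ m s (w : (Fin s → Fin r) → ℕ) → Extensional w →
                        (ι : Fin s → Fin m) → Injective _≡_ _≡_ ι →
                        sumMaps m (λ f → w (f ∘ ι)) ≡ r ^ (m ∸ s) * sumMaps s w
  sumMaps-∘-injective zero zero w ext ι _ = trans (ext (λ ())) (sym (*-identityˡ _))
  sumMaps-∘-injective zero (suc s) w ext ι _ with ι zero
  ... | ()
  -- The colour at position 0 contributes a free factor r, unless 0 = ι k: then it becomes the
  -- entry inserted at k into the restricted colouring.
  sumMaps-∘-injective (suc m) s w ext ι ι-inj with any? (λ k → ι k ≟ᶠ zero)
  ... | no zero∉ι = begin
      ∑[ c < r ] sumMaps m (λ f → w ((c ∷ᵛ f) ∘ ι))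
    ≡⟨ sum-cong-≗ {r} (λ c → sumMaps-cong m (λ f → ext (cong (c ∷ᵛ f) ∘ sym ∘ suc-dropZero ι avoid))) ⟩
      ∑[ c < r ] sumMaps m (λ f → w (f ∘ ι′))
    ≡⟨ sum-cong-≗ {r} (λ c → sumMaps-∘-injective m s w ext ι′ (dropZero-injective ι avoid ι-inj)) ⟩
      ∑[ c < r ] (r ^ (m ∸ s) * sumMaps s w)
    ≡⟨ sum-const r _ ⟩
      r * (r ^ (m ∸ s) * sumMaps s w)
    ≡⟨ sym (*-assoc r _ _) ⟩
      r ^ suc (m ∸ s) * sumMaps s w
    ≡⟨ cong (λ t → r ^ t * sumMaps s w) (+-∸-assoc 1 (injective⇒≤ (dropZero-injective ι avoid ι-inj))) ⟨
      r ^ (suc m ∸ s) * sumMaps s w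
    ∎
    where
    open ≡-Reasoning
    avoid : ∀ k → zero ≢ ι k
    avoid k e = zero∉ι (k , sym e)
    ι′ : Fin s → Fin m
    ι′ = dropZero ι avoid
  sumMaps-∘-injective (suc m) (suc s) w ext ι ι-inj | yes (k , ιk≡0) = begin
      ∑[ c < r ] sumMaps m (λ f → w ((c ∷ᵛ f) ∘ ι))
    ≡⟨ sum-cong-≗ {r} (λ c → sumMaps-cong m (λ f → ext (∘ι≗insertAt c f))) ⟩
      ∑[ c < r ] sumMaps m (λ f → w (insertAt (f ∘ ι′) k c))
    ≡⟨ sum-cong-≗ {r} (λ c → sumMaps-∘-injective m s (λ f → w (insertAt f k c))
                               (ext ∘ insertAt-cong {k = k} {c}) ι′ ι′-injective) ⟩
      ∑[ c < r ] (r ^ (m ∸ s) * sumMaps s (λ f → w (insertAt f k c)))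
    ≡⟨ sym (*-distribˡ-sum (r ^ (m ∸ s)) (λ c → sumMaps s (λ f → w (insertAt f k c)))) ⟩
      r ^ (m ∸ s) * ∑[ c < r ] sumMaps s (λ f → w (insertAt f k c))
    ≡⟨ cong (r ^ (m ∸ s) *_) (sym (sumMaps-insertAt s w ext k)) ⟩
      r ^ (m ∸ s) * sumMaps (suc s) w
    ∎
    where
    open ≡-Reasoning
    ι∘punchIn : Fin s → Fin (suc m)
    ι∘punchIn = ι ∘ punchIn k
    avoid : ∀ j → zero ≢ ι∘punchIn j
    avoid j e = punchInᵢ≢i k j (ι-inj (trans (sym e) (sym ιk≡0)))
    ι′ : Fin s → Fin m
    ι′ = dropZero ι∘punchIn avoid
    ι′-injective : Injective _≡_ _≡_ ι′
    ι′-injective = dropZero-injective ι∘punchIn avoid (punchIn-injective k _ _ ∘ ι-inj)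
    ∘ι≗insertAt : ∀ c f → (c ∷ᵛ f) ∘ ι ≗ insertAt (f ∘ ι′) k c
    ∘ι≗insertAt c f = ≗-insertAt ((c ∷ᵛ f) ∘ ι) k (f ∘ ι′) c (cong (c ∷ᵛ f) ιk≡0)
                        (λ j → cong (c ∷ᵛ f) (sym (suc-dropZero ι∘punchIn avoid j)))

Rainbow : ∀ {r} → Fin r → Fin r → Fin r → Set
Rainbow a u v = a ≢ u × u ≢ v × a ≢ v

rainbow? : ∀ {r} (a u v : Fin r) → Dec (Rainbow a u v)
rainbow? a u v = ¬? (a ≟ᶠ u) ×-dec ¬? (u ≟ᶠ v) ×-dec ¬? (a ≟ᶠ v)

nonRainbow : ∀ {r} → Fin r → Fin r → Fin r → ℕ
nonRainbow a u v = indicator (¬? (rainbow? a u v))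

nonRainbow≤1 : ∀ {r} (a u v : Fin r) → nonRainbow a u v ≤ 1
nonRainbow≤1 a u v with a ≟ᶠ u | u ≟ᶠ v | a ≟ᶠ v
... | yes _ | _     | _     = s≤s z≤n
... | no _  | yes _ | _     = s≤s z≤n
... | no _  | no _  | yes _ = s≤s z≤n
... | no _  | no _  | no _  = z≤n

nonRainbow-≤ : ∀ {r} (a u v : Fin r) → a ≢ u →
               nonRainbow a u v ≤ indicator (u ≟ᶠ v) + indicator (a ≟ᶠ v)
nonRainbow-≤ a u v a≢u with a ≟ᶠ u | u ≟ᶠ v | a ≟ᶠ v
... | yes a≡u | _     | _     = ⊥-elim (a≢u a≡u)
... | no _    | yes _ | _     = s≤s z≤n
... | no _    | no _  | yes _ = s≤s z≤n
... | no _    | no _  | no _  = z≤n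

nonRainbow≡0⇒Rainbow : ∀ {r} (a u v : Fin r) → nonRainbow a u v ≡ 0 → Rainbow a u v
nonRainbow≡0⇒Rainbow a u v eq with a ≟ᶠ u | u ≟ᶠ v | a ≟ᶠ v
nonRainbow≡0⇒Rainbow a u v () | yes _ | _     | _
nonRainbow≡0⇒Rainbow a u v () | no _  | yes _ | _
nonRainbow≡0⇒Rainbow a u v () | no _  | no _  | yes _
... | no a≢u | no u≢v | no a≢v = a≢u , u≢v , a≢v

∑-indicator-≟≡1 : ∀ {k} (x : Fin (suc k)) → ∑[ v < suc k ] indicator (x ≟ᶠ v) ≡ 1
∑-indicator-≟≡1 {k} x = begin
    ∑[ v < suc k ] indicator (x ≟ᶠ v)
  ≡⟨ sum-remove {i = x} (λ v → indicator (x ≟ᶠ v)) ⟩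
    indicator (x ≟ᶠ x) + ∑[ j < k ] indicator (x ≟ᶠ punchIn x j)
  ≡⟨ cong₂ _+_ (x≟x≡1) (sum-cong-≗ {k} x≟punchIn≡0) ⟩
    1 + ∑[ j < k ] 0
  ≡⟨ cong suc (trans (sum-const k 0) (*-zeroʳ k)) ⟩
    1
  ∎
  where
  open ≡-Reasoning
  x≟x≡1 : indicator (x ≟ᶠ x) ≡ 1
  x≟x≡1 with x ≟ᶠ x
  ... | yes _   = refl
  ... | no x≢x = ⊥-elim (x≢x refl)
  x≟punchIn≡0 : ∀ j → indicator (x ≟ᶠ punchIn x j) ≡ 0
  x≟punchIn≡0 j with x ≟ᶠ punchIn x j
  ... | yes x≡ = ⊥-elim (punchInᵢ≢i x j (sym x≡))
  ... | no _   = refl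

∑∑nonRainbow≤ : ∀ {r} (a : Fin r) → ∑[ u < r ] ∑[ v < r ] nonRainbow a u v ≤ 3 * r ∸ 2
∑∑nonRainbow≤ {suc k} a = begin
    ∑[ u < suc k ] F u
  ≡⟨ sum-remove {i = a} F ⟩
    F a + ∑[ j < k ] F (punchIn a j)
  ≤⟨ +-mono-≤ F[a]≤ (sum-mono-≤ F[punchIn]≤2) ⟩
    suc k * 1 + ∑[ j < k ] 2
  ≡⟨ cong₂ _+_ (*-identityʳ (suc k)) (sum-const k 2) ⟩
    suc k + k * 2
  ≡⟨ m+n∸m≡n 2 (suc k + k * 2) ⟨
    2 + (suc k + k * 2) ∸ 2
  ≡⟨ cong (_∸ 2) (split k) ⟨
    3 * suc k ∸ 2
  ∎
  where
  open ≤-Reasoning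
  split : ∀ k → 3 * suc k ≡ 2 + (suc k + k * 2)
  split = solve-∀
  F : Fin (suc k) → ℕ
  F u = ∑[ v < suc k ] nonRainbow a u v
  F[a]≤ : F a ≤ suc k * 1
  F[a]≤ = ≤-trans (sum-mono-≤ (nonRainbow≤1 a a)) (≤-reflexive (sum-const (suc k) 1))
  F[punchIn]≤2 : ∀ j → F (punchIn a j) ≤ 2
  F[punchIn]≤2 j = let u = punchIn a j in begin
      F u
    ≤⟨ sum-mono-≤ (λ v → nonRainbow-≤ a u v (punchInᵢ≢i a j ∘ sym)) ⟩
      ∑[ v < suc k ] (indicator (u ≟ᶠ v) + indicator (a ≟ᶠ v))
    ≡⟨ ∑-distrib-+ (λ v → indicator (u ≟ᶠ v)) (λ v → indicator (a ≟ᶠ v)) ⟩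
      ∑[ v < suc k ] indicator (u ≟ᶠ v) + ∑[ v < suc k ] indicator (a ≟ᶠ v)
    ≡⟨ cong₂ _+_ (∑-indicator-≟≡1 u) (∑-indicator-≟≡1 a) ⟩
      2
    ∎

flatten : ∀ {a} {X : Set a} → List (X × X) → List X
flatten []             = []
flatten ((x , y) ∷ ps) = x ∷ y ∷ flatten ps

length-flatten : ∀ {a} {X : Set a} (ps : List (X × X)) → length (flatten ps) ≡ length ps + length ps
length-flatten []             = refl
length-flatten ((x , y) ∷ ps) = cong suc (trans (cong suc (length-flatten ps)) (sym (+-suc _ _)))

lookup-injective : ∀ {a} {X : Set a} {xs : List X} → Unique xs → Injective _≡_ _≡_ (lookup xs)
lookup-injective (_ ∷ _)   {zero}  {zero}  _ = refl
lookup-injective (x∉ ∷ _)  {zero}  {suc j} e = ⊥-elim (All.lookup x∉ (∈-lookup j) e)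
lookup-injective (x∉ ∷ _)  {suc i} {zero}  e = ⊥-elim (All.lookup x∉ (∈-lookup i) (sym e))
lookup-injective (_ ∷ xs!) {suc i} {suc j} e = cong suc (lookup-injective xs! e)

FormsSum : ℕ → ℕ → ℕ → Set
FormsSum e x y = x + y ≡ e ⊎ e + x ≡ y

module _ (r : ℕ) where
  open MapSums r

  pairsWeight : ∀ {a} {X : Set a} (ps : List (X × X)) → Fin r → (Fin (length (flatten ps)) → Fin r) → ℕ
  pairsWeight []             a f = 1
  pairsWeight ((_ , _) ∷ ps) a f =
    nonRainbow a (f zero) (f (suc zero)) * pairsWeight ps a (λ t → f (suc (suc t)))

  pairsWeight-cong : ∀ {a} {X : Set a} (ps : List (X × X)) c {f g} → f ≗ g →
                     pairsWeight ps c f ≡ pairsWeight ps c g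
  pairsWeight-cong []             c f≗g = refl
  pairsWeight-cong ((_ , _) ∷ ps) c f≗g =
    cong₂ _*_ (cong₂ (nonRainbow c) (f≗g zero) (f≗g (suc zero)))
              (pairsWeight-cong ps c (λ t → f≗g (suc (suc t))))

  starWeight : ∀ {a} {X : Set a} (ps : List (X × X)) → (Fin (suc (length (flatten ps))) → Fin r) → ℕ
  starWeight ps f = pairsWeight ps (f zero) (f ∘ suc)

  starWeight-extensional : ∀ {a} {X : Set a} (ps : List (X × X)) → Extensional (starWeight ps)
  starWeight-extensional ps {f} {g} f≗g =
    trans (cong (λ c → pairsWeight ps c (f ∘ suc)) (f≗g zero)) (pairsWeight-cong ps (g zero) (f≗g ∘ suc))

  module _ (D : ℕ) (D-bound : ∀ a → ∑[ u < r ] ∑[ v < r ] nonRainbow a u v ≤ D) where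

    sumMaps-pairsWeight : ∀ {a} {X : Set a} (ps : List (X × X)) c →
                          sumMaps (length (flatten ps)) (pairsWeight ps c) ≤ D ^ length ps
    sumMaps-pairsWeight []             c = ≤-refl
    sumMaps-pairsWeight ((_ , _) ∷ ps) c = begin
        ∑[ u < r ] ∑[ v < r ] sumMaps L (λ f → nonRainbow c u v * pairsWeight ps c f)
      ≡⟨ sum-cong-≗ {r} (λ u → sum-cong-≗ {r} (λ v →
           *-distribˡ-sumMaps L (nonRainbow c u v) (pairsWeight ps c))) ⟨
        ∑[ u < r ] ∑[ v < r ] (nonRainbow c u v * sumMaps L (pairsWeight ps c))
      ≤⟨ sum-mono-≤ (λ u → sum-mono-≤ (λ v →
           *-monoʳ-≤ (nonRainbow c u v) (sumMaps-pairsWeight ps c))) ⟩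
        ∑[ u < r ] ∑[ v < r ] (nonRainbow c u v * D ^ length ps)
      ≡⟨ sum-cong-≗ {r} (λ u → sym (*-distribʳ-sum (D ^ length ps) (nonRainbow c u))) ⟩
        ∑[ u < r ] (∑[ v < r ] nonRainbow c u v * D ^ length ps)
      ≡⟨ sym (*-distribʳ-sum (D ^ length ps) (λ u → ∑[ v < r ] nonRainbow c u v)) ⟩
        ∑[ u < r ] ∑[ v < r ] nonRainbow c u v * D ^ length ps
      ≤⟨ *-monoˡ-≤ _ (D-bound c) ⟩
        D ^ suc (length ps)
      ∎
      where
      open ≤-Reasoning
      L : ℕ
      L = length (flatten ps)

    sumMaps-starWeight : ∀ {a} {X : Set a} (ps : List (X × X)) →
                         sumMaps (suc (length (flatten ps))) (starWeight ps) ≤ r * D ^ length ps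
    sumMaps-starWeight ps =
      ≤-trans (sum-mono-≤ (sumMaps-pairsWeight ps)) (≤-reflexive (sum-const r _))

FormsSumAt : (A : List ℕ) → Fin (length A) → Fin (length A) × Fin (length A) → Set
FormsSumAt A e (i , j) = FormsSum (lookup A e) (lookup A i) (lookup A j)

module _ (A : List ℕ) (r : ℕ) where
  open MapSums r

  private
    m : ℕ
    m = length A

  rainbowSumFree⇒1≤nonRainbow : (χ : Colouring A r) → RainbowSumFree A r χ → ∀ e i j →
                              e ≢ i → i ≢ j → e ≢ j → FormsSumAt A e (i , j) →
                              1 ≤ nonRainbow (χ e) (χ i) (χ j)
  rainbowSumFree⇒1≤nonRainbow χ free e i j e≢i i≢j e≢j sum with nonRainbow (χ e) (χ i) (χ j) in eq
  ... | suc _ = s≤s z≤n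
  ... | zero  with nonRainbow≡0⇒Rainbow (χ e) (χ i) (χ j) eq | sum
  ...   | χe≢χi , χi≢χj , χe≢χj | inj₁ i+j≡e =
    ⊥-elim $ free
      (i , j , e , (i≢j , e≢j ∘ sym , e≢i ∘ sym) , i+j≡e , (χi≢χj , χe≢χj ∘ sym , χe≢χi ∘ sym))
  ...   | χe≢χi , χi≢χj , χe≢χj | inj₂ e+i≡j =
    ⊥-elim $ free (e , i , j , (e≢i , i≢j , e≢j) , e+i≡j , (χe≢χi , χi≢χj , χe≢χj))

  rainbowSumFree⇒1≤pairsWeight : (χ : Colouring A r) → RainbowSumFree A r χ →
    (e : Fin m) (ps : List (Fin m × Fin m)) → Unique (e ∷ flatten ps) → All (FormsSumAt A e) ps →
    1 ≤ pairsWeight r ps (χ e) (λ t → χ (lookup (flatten ps) t))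
  rainbowSumFree⇒1≤pairsWeight χ free e [] _ _ = s≤s z≤n
  rainbowSumFree⇒1≤pairsWeight χ free e ((i , j) ∷ ps)
    ((e≢i ∷ e≢j ∷ e∉ps) ∷ (i≢j ∷ _) ∷ _ ∷ ps!) (sum ∷ sums) =
    *-mono-≤ {1} {_} {1} (rainbowSumFree⇒1≤nonRainbow χ free e i j e≢i i≢j e≢j sum)
                         (rainbowSumFree⇒1≤pairsWeight χ free e ps (e∉ps ∷ ps!) sums)

  g≤-indexPairs : (e : Fin m) (ps : List (Fin m × Fin m)) →
                  Unique (e ∷ flatten ps) → All (FormsSumAt A e) ps →
                  ∀ D → (∀ a → ∑[ u < r ] ∑[ v < r ] nonRainbow a u v ≤ D) →
                  g A r ≤ r ^ (m ∸ suc (length (flatten ps))) * (r * D ^ length ps)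
  g≤-indexPairs e ps e∷ps! sums D D-bound = begin
      g A r
    ≡⟨ length-filter-allMaps m (λ χ → ¬? (rainbowSum? A r χ)) ⟩
      sumMaps m (λ χ → indicator (¬? (rainbowSum? A r χ)))
    ≤⟨ sumMaps-mono-≤ m indicator≤weight ⟩
      sumMaps m (λ χ → starWeight r ps (χ ∘ ι))
    ≡⟨ sumMaps-∘-injective m s (starWeight r ps) (starWeight-extensional r ps) ι (lookup-injective e∷ps!) ⟩
      r ^ (m ∸ s) * sumMaps s (starWeight r ps)
    ≤⟨ *-monoʳ-≤ (r ^ (m ∸ s)) (sumMaps-starWeight r D D-bound ps) ⟩
      r ^ (m ∸ s) * (r * D ^ length ps)
    ∎
    where
    open ≤-Reasoning
    s : ℕ
    s = suc (length (flatten ps))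
    ι : Fin s → Fin m
    ι = lookup (e ∷ flatten ps)
    indicator≤weight : ∀ χ → indicator (¬? (rainbowSum? A r χ)) ≤ starWeight r ps (χ ∘ ι)
    indicator≤weight χ with rainbowSum? A r χ
    ... | yes _    = z≤n
    ... | no free = rainbowSumFree⇒1≤pairsWeight χ free e ps e∷ps! sums

1+2*_ : ℕ → ℕ
1+2* k = suc (k * 2)

odd-1+2* : ∀ k → Odd (1+2* k)
odd-1+2* k = [m+kn]%n≡m%n 1 k 2

odd⇒≡1+2* : ∀ {x} → Odd x → x ≡ 1+2* (x div 2)
odd⇒≡1+2* {x} odd = trans (m≡m%n+[m/n]*n x 2) (cong (_+ x div 2 * 2) odd)

¬odd⇒even : ∀ {x} → ¬ Odd x → ∃[ q ] x ≡ q * 2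
¬odd⇒even {x} ¬odd =
  x div 2 , trans (m≡m%n+[m/n]*n x 2) (cong (_+ x div 2 * 2) (rem≡0 (x % 2) refl (m%n<n x 2)))
  where
  rem≡0 : ∀ v → x % 2 ≡ v → v < 2 → v ≡ 0
  rem≡0 0             _   _                 = refl
  rem≡0 1             x%2 _                 = ⊥-elim (¬odd x%2)
  rem≡0 (suc (suc _)) _   (s≤s (s≤s ()))

1+2*≤⇒<⌈/2⌉ : ∀ k n → 1+2* k ≤ n → k < ⌈ n /2⌉
1+2*≤⇒<⌈/2⌉ zero    (suc n)       _                 = s≤s z≤n
1+2*≤⇒<⌈/2⌉ (suc k) (suc (suc n)) (s≤s (s≤s 1+2k≤n)) = s≤s (1+2*≤⇒<⌈/2⌉ k n 1+2k≤n)

OddAtMost : ℕ → ℕ → Set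
OddAtMost n x = Odd x × x ≤ n

length-oddsAtMost≤⌈/2⌉ : ∀ n {xs} → Unique xs → All (OddAtMost n) xs → length xs ≤ ⌈ n /2⌉
length-oddsAtMost≤⌈/2⌉ n {xs} xs! odds = injective⇒≤ {f = half} half-injective
  where
  oddAt : ∀ i → OddAtMost n (lookup xs i)
  oddAt i = All.lookup odds (∈-lookup i)
  half : Fin (length xs) → Fin ⌈ n /2⌉
  half i = let (odd , ≤n) = oddAt i in
           fromℕ< (1+2*≤⇒<⌈/2⌉ (lookup xs i div 2) n (subst (_≤ n) (odd⇒≡1+2* odd) ≤n))
  half-injective : ∀ {i j} → half i ≡ half j → i ≡ j
  half-injective {i} {j} eq = lookup-injective xs! (begin
    lookup xs i              ≡⟨ odd⇒≡1+2* (proj₁ (oddAt i)) ⟩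
    1+2* (lookup xs i div 2) ≡⟨ cong 1+2*_ (fromℕ<-injective (lookup xs i div 2) (lookup xs j div 2) _ _ eq) ⟩
    1+2* (lookup xs j div 2) ≡⟨ odd⇒≡1+2* (proj₁ (oddAt j)) ⟨
    lookup xs j              ∎)
    where open ≡-Reasoning

record OddSumPairs (n e T : ℕ) : Set where
  field
    pairs     : List (ℕ × ℕ)
    unique    : Unique (flatten pairs)
    formsSum  : All (λ (x , y) → FormsSum e x y) pairs
    oddAtMost : All (OddAtMost n) (flatten pairs)
    length≥   : T ≤ length pairs

Disjoint₂ : ∀ {a} {X : Set a} → X × X → X × X → Set a
Disjoint₂ (x , y) (u , v) = x ≢ u × x ≢ v × y ≢ u × y ≢ v

All-flatten : ∀ {a p} {X : Set a} {P : X → Set p} (ps : List (X × X)) →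
              All (λ (x , y) → P x × P y) ps → All P (flatten ps)
All-flatten []             []               = []
All-flatten ((x , y) ∷ ps) ((px , py) ∷ qs) = px ∷ py ∷ All-flatten ps qs

unique-flatten : ∀ {a} {X : Set a} (ps : List (X × X)) → AllPairs Disjoint₂ ps → All (λ (x , y) → x ≢ y) ps →
                 Unique (flatten ps)
unique-flatten []             []           []          = []
unique-flatten ((x , y) ∷ ps) (dis ∷ diss) (x≢y ∷ ≢s) =
  (x≢y ∷ All-flatten ps (All.map (λ (x≢u , x≢v , _) → x≢u , x≢v) dis))
  ∷ All-flatten ps (All.map (λ (_ , _ , y≢u , y≢v) → y≢u , y≢v) dis)
  ∷ unique-flatten ps diss ≢s

1+2*-injective : ∀ {x y} → 1+2* x ≡ 1+2* y → x ≡ y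
1+2*-injective e = *-cancelʳ-≡ _ _ 2 (suc-injective e)

1+2*<⇒≤2* : ∀ {k q} → k < q → 1+2* k ≤ q * 2
1+2*<⇒≤2* {k} k<q = ≤-trans (n≤1+n (1+2* k)) (*-monoˡ-≤ 2 k<q)

1+2*≢2* : ∀ m k → 1+2* m ≢ k * 2
1+2*≢2* m k e with trans (sym (odd-1+2* m)) (trans (cong (_% 2) e) ([m+kn]%n≡m%n 0 k 2))
... | ()

oddSumPairs-from : ∀ n e T (a b : ℕ → ℕ) →
  (∀ {i j} → i < j → j < T → a i ≢ a j × a i ≢ b j × b i ≢ a j × b i ≢ b j) →
  (∀ {i} → i < T → a i ≢ b i × FormsSum e (1+2* (a i)) (1+2* (b i)) ×
                   1+2* (a i) ≤ n × 1+2* (b i) ≤ n) →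
  OddSumPairs n e T
oddSumPairs-from n e T a b disjoint valid = record
  { pairs     = ps
  ; unique    = unique-flatten ps
                  (AllPairs.applyUpTo⁺₁ pair T λ i<j j<T → 1+2*-Disjoint₂ (disjoint i<j j<T))
                  (All.applyUpTo⁺₁ pair T λ i<T → 1+2*-≢ (proj₁ (valid i<T)))
  ; formsSum  = All.applyUpTo⁺₁ pair T λ i<T → proj₁ (proj₂ (valid i<T))
  ; oddAtMost = All-flatten ps (All.applyUpTo⁺₁ pair T λ {i} i<T →
                  let (_ , _ , a≤n , b≤n) = valid i<T in (odd-1+2* (a i) , a≤n) , (odd-1+2* (b i) , b≤n))
  ; length≥   = ≤-reflexive (sym (length-applyUpTo pair T))
  }
  where
  pair : ℕ → ℕ × ℕ
  pair i = 1+2* (a i) , 1+2* (b i)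
  ps : List (ℕ × ℕ)
  ps = applyUpTo pair T
  1+2*-≢ : ∀ {x y} → x ≢ y → 1+2* x ≢ 1+2* y
  1+2*-≢ x≢y = x≢y ∘′ 1+2*-injective
  1+2*-Disjoint₂ : ∀ {i j} → a i ≢ a j × a i ≢ b j × b i ≢ a j × b i ≢ b j →
                   Disjoint₂ (pair i) (pair j)
  1+2*-Disjoint₂ (p , q , r , s) = 1+2*-≢ p , 1+2*-≢ q , 1+2*-≢ r , 1+2*-≢ s

oddSumPairs-sum : ∀ n q T → T + T ≤ q → q * 2 ≤ n → OddSumPairs n (q * 2) T
oddSumPairs-sum n q T 2T≤q 2q≤n = oddSumPairs-from n (q * 2) T (λ i → i) b disjoint valid
  where
  b : ℕ → ℕ
  b i = q ∸ suc i
  T≤q : T ≤ q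
  T≤q = ≤-trans (m≤m+n T T) 2T≤q
  b+1+i≡q : ∀ {i} → i < T → b i + suc i ≡ q
  b+1+i≡q i<T = m∸n+n≡m (≤-trans i<T T≤q)
  T≤b : ∀ {i} → i < T → T ≤ b i
  T≤b {i} i<T = +-cancelʳ-≤ T T (b i)
    (≤-trans 2T≤q (≤-trans (≤-reflexive (sym (b+1+i≡q i<T))) (+-monoʳ-≤ (b i) i<T)))
  b<q : ∀ {i} → i < T → b i < q
  b<q {i} i<T = subst (b i <_) (b+1+i≡q i<T) (m<m+n (b i) (s≤s z≤n))
  1+2*+1+2* : ∀ i j → suc (i * 2) + suc (j * 2) ≡ (j + suc i) * 2
  1+2*+1+2* = solve-∀
  disjoint : ∀ {i j} → i < j → j < T → i ≢ j × i ≢ b j × b i ≢ j × b i ≢ b j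
  disjoint {i} {j} i<j j<T =
      <⇒≢ i<j
    , <⇒≢ (<-≤-trans (<-trans i<j j<T) (T≤b j<T))
    , (λ e → <⇒≢ (<-≤-trans j<T (T≤b (<-trans i<j j<T))) (sym e))
    , (λ e → <⇒≢ i<j (suc-injective (+-cancelˡ-≡ (b i) _ _
        (trans (b+1+i≡q (<-trans i<j j<T)) (trans (sym (b+1+i≡q j<T)) (cong (_+ suc j) (sym e)))))))
  valid : ∀ {i} → i < T → i ≢ b i × FormsSum (q * 2) (1+2* i) (1+2* (b i)) ×
                          1+2* i ≤ n × 1+2* (b i) ≤ n
  valid {i} i<T =
      <⇒≢ (<-≤-trans i<T (T≤b i<T))
    , inj₁ (trans (1+2*+1+2* i (b i)) (cong (_* 2) (b+1+i≡q i<T)))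
    , ≤-trans (1+2*<⇒≤2* (<-≤-trans i<T T≤q)) 2q≤n
    , ≤-trans (1+2*<⇒≤2* (b<q i<T)) 2q≤n

private
  <-by-quotient : ∀ q u v s t → u < q → s < t → u + q * s < v + q * t
  <-by-quotient q u v s t u<q s<t = <-≤-trans (+-monoˡ-< (q * s) u<q)
    (≤-trans (≤-reflexive (sym (*-suc q s))) (≤-trans (*-monoʳ-≤ q s<t) (m≤n+m (q * t) v)))

  quotient-unique : ∀ q u v s t → u < q → v < q → u + q * s ≡ v + q * t → s ≡ t
  quotient-unique q u v s t u<q v<q e with <-cmp s t
  ... | tri≈ _ s≡t _ = s≡t
  ... | tri< s<t _ _ = ⊥-elim (<-irrefl e (<-by-quotient q u v s t u<q s<t))
  ... | tri> _ _ t<s = ⊥-elim (<-irrefl (sym e) (<-by-quotient q v u t s v<q t<s))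

oddSumPairs-shift : ∀ n q′ → let q = suc q′ in OddSumPairs n (q * 2) (n div (q * 4) * q)
oddSumPairs-shift n q′ = oddSumPairs-from n (q * 2) T a b disjoint valid
  where
  -- a enumerates the integers whose quotient by q is even and b = a + q those whose quotient
  -- is odd, so no a i equals any b j; then 1+2* (b i) = 1+2* (a i) + e.
  q S T : ℕ
  q = suc q′
  S = n div (q * 4)
  T = S * q
  a : ℕ → ℕ
  a x = x + x div q * q
  b : ℕ → ℕ
  b x = a x + q
  a≡ : ∀ x → a x ≡ x % q + q * (x div q * 2)
  a≡ x = trans (cong (_+ x div q * q) (m≡m%n+[m/n]*n x q)) (rearrange (x % q) (x div q) q)
    where
    rearrange : ∀ u s q → u + s * q + s * q ≡ u + q * (s * 2)
    rearrange = solve-∀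
  b≡ : ∀ x → b x ≡ x % q + q * suc (x div q * 2)
  b≡ x = trans (cong (λ t → t + x div q * q + q) (m≡m%n+[m/n]*n x q)) (rearrange (x % q) (x div q) q)
    where
    rearrange : ∀ u s q → u + s * q + s * q + q ≡ u + q * suc (s * 2)
    rearrange = solve-∀
  b≢a : ∀ x y → b x ≢ a y
  b≢a x y e = 1+2*≢2* (x div q) (y div q)
    (quotient-unique q (x % q) (y % q) _ _ (m%n<n x q) (m%n<n y q) (trans (sym (b≡ x)) (trans e (a≡ y))))
  a-mono : ∀ {i j} → i < j → a i < a j
  a-mono {i} {j} i<j = +-mono-<-≤ i<j (*-monoˡ-≤ q (/-monoˡ-≤ q (<⇒≤ i<j)))
  b< : ∀ {i} → i < T → b i < S * (q * 2)
  b< {i} i<T = begin-strict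
      b i                             ≡⟨ b≡ i ⟩
      i % q + q * suc (i div q * 2)   <⟨ +-monoˡ-< (q * suc (i div q * 2)) (m%n<n i q) ⟩
      q + q * suc (i div q * 2)       ≡⟨ rearrange (i div q) q ⟩
      suc (i div q) * (q * 2)         ≤⟨ *-monoˡ-≤ (q * 2) (m<n*o⇒m/o<n {i} {S} {q} i<T) ⟩
      S * (q * 2)                     ∎
    where
    open ≤-Reasoning
    rearrange : ∀ s q → q + q * suc (s * 2) ≡ suc s * (q * 2)
    rearrange = solve-∀
  1+2*≤n : ∀ {k} → k < S * (q * 2) → 1+2* k ≤ n
  1+2*≤n k< = ≤-trans (1+2*<⇒≤2* k<) (≤-trans (≤-reflexive (rearrange S q)) (m/n*n≤m n (q * 4)))
    where
    rearrange : ∀ S q → S * (q * 2) * 2 ≡ S * (q * 4)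
    rearrange = solve-∀
  a<b : ∀ i → a i < b i
  a<b i = m<m+n (a i) (s≤s z≤n)
  disjoint : ∀ {i j} → i < j → j < T → a i ≢ a j × a i ≢ b j × b i ≢ a j × b i ≢ b j
  disjoint {i} {j} i<j j<T = <⇒≢ (a-mono i<j) , (λ e → b≢a j i (sym e)) , b≢a i j
    , (λ e → <⇒≢ (a-mono i<j) (+-cancelʳ-≡ q (a i) (a j) e))
  valid : ∀ {i} → i < T → a i ≢ b i × FormsSum (q * 2) (1+2* (a i)) (1+2* (b i)) ×
                          1+2* (a i) ≤ n × 1+2* (b i) ≤ n
  valid {i} i<T = <⇒≢ (a<b i) , inj₂ (e+1+2* (a i) q) , 1+2*≤n (<-trans (a<b i) (b< i<T)) , 1+2*≤n (b< i<T)
    where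
    e+1+2* : ∀ x q → q * 2 + suc (x * 2) ≡ suc ((x + q) * 2)
    e+1+2* = solve-∀

OddSumPairs-weaken : ∀ {n e T T′} → T′ ≤ T → OddSumPairs n e T → OddSumPairs n e T′
OddSumPairs-weaken T′≤T ps =
  record { OddSumPairs ps hiding (length≥) ; length≥ = ≤-trans T′≤T (OddSumPairs.length≥ ps) }

private
  T+T≤q : ∀ n q T → 18 * T ≤ n + 18 → n + 27 ≤ 9 * q → T + T ≤ q
  T+T≤q n q T 18T≤ n+27≤ = ≤-trans (m≤m+n (T + T) 1) (*-cancelˡ-≤ 9 (begin
      9 * (T + T + 1)  ≡⟨ regroup T ⟩
      18 * T + 9       ≤⟨ +-monoˡ-≤ 9 18T≤ ⟩
      n + 18 + 9       ≡⟨ +-assoc n 18 9 ⟩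
      n + 27           ≤⟨ n+27≤ ⟩
      9 * q            ∎))
    where
    open ≤-Reasoning
    regroup : ∀ T → 9 * (T + T + 1) ≡ 18 * T + 9
    regroup = solve-∀

  n+1≤4Sq+4q : ∀ n q′ → let q = suc q′ in n + 1 ≤ (n div (q * 4) * q) * 4 + q * 4
  n+1≤4Sq+4q n q′ = begin
      n + 1                                 ≡⟨ +-comm n 1 ⟩
      suc n                                 ≡⟨ cong suc (m≡m%n+[m/n]*n n (q * 4)) ⟩
      suc (n % (q * 4) + n div (q * 4) * (q * 4)) ≤⟨ +-monoˡ-≤ _ (m%n<n n (q * 4)) ⟩
      q * 4 + n div (q * 4) * (q * 4)         ≡⟨ regroup (n div (q * 4)) q ⟩
      (n div (q * 4) * q) * 4 + q * 4         ∎
    where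
    open ≤-Reasoning
    q : ℕ
    q = suc q′
    regroup : ∀ S q → q * 4 + S * (q * 4) ≡ (S * q) * 4 + q * 4
    regroup = solve-∀

  T≤S : ∀ n q T S → 72 ≤ n → 18 * T ≤ n + 18 → 9 * q ≤ n + 26 → n + 1 ≤ S * 4 + q * 4 → T ≤ S
  T≤S n q T S 72≤n 18T≤ 9q≤ n+1≤ = *-cancelˡ-≤ 36 (+-cancelʳ-≤ (4 * n + 104) _ _ (begin
      36 * T + (4 * n + 104)        ≡⟨ cong (_+ (4 * n + 104)) (*-assoc 2 18 T) ⟩
      2 * (18 * T) + (4 * n + 104)  ≤⟨ +-monoˡ-≤ _ (*-monoʳ-≤ 2 18T≤) ⟩
      2 * (n + 18) + (4 * n + 104)  ≡⟨ regroup₁ n ⟩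
      6 * n + 140                   ≤⟨ +-monoʳ-≤ (6 * n) (+-monoˡ-≤ 9 131≤3n) ⟩
      6 * n + (3 * n + 9)           ≡⟨ regroup₂ n ⟩
      9 * (n + 1)                   ≤⟨ *-monoʳ-≤ 9 n+1≤ ⟩
      9 * (S * 4 + q * 4)           ≡⟨ regroup₃ S q ⟩
      36 * S + 4 * (9 * q)          ≤⟨ +-monoʳ-≤ (36 * S) (*-monoʳ-≤ 4 9q≤) ⟩
      36 * S + 4 * (n + 26)         ≡⟨ cong (λ x → 36 * S + x) (*-distribˡ-+ 4 n 26) ⟩
      36 * S + (4 * n + 104)        ∎))
    where
    open ≤-Reasoning
    131≤3n : 131 ≤ 3 * n
    131≤3n = ≤-trans (m≤m+n 131 85) (*-monoʳ-≤ 3 72≤n)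
    regroup₁ : ∀ n → 2 * (n + 18) + (4 * n + 104) ≡ 6 * n + 140
    regroup₁ = solve-∀
    regroup₂ : ∀ n → 6 * n + (3 * n + 9) ≡ 9 * (n + 1)
    regroup₂ = solve-∀
    regroup₃ : ∀ S q → 9 * (S * 4 + q * 4) ≡ 36 * S + 4 * (9 * q)
    regroup₃ = solve-∀

oddSumPairs : ∀ n q T → 1 ≤ q → q * 2 ≤ n → 72 ≤ n → 18 * T ≤ n + 18 → OddSumPairs n (q * 2) T
oddSumPairs n zero      T () _ _ _
oddSumPairs n q@(suc q′) T _ 2q≤n 72≤n 18T≤ with n + 27 ≤? 9 * q
... | yes n+27≤9q = oddSumPairs-sum n q T (T+T≤q n q T 18T≤ n+27≤9q) 2q≤n
... | no n+27≰9q =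
  OddSumPairs-weaken (T≤S n q T _ 72≤n 18T≤ 9q≤n+26 (n+1≤4Sq+4q n q′)) (oddSumPairs-shift n q′)
  where
  9q≤n+26 : 9 * q ≤ n + 26
  9q≤n+26 = ≤-pred (subst (9 * q <_) (+-suc n 26) (≰⇒> n+27≰9q))

flatten⁺ : ∀ {a} {X : Set a} {ps qs : List (X × X)} → ps ⊆ qs → flatten ps ⊆ flatten qs
flatten⁺ []                = []
flatten⁺ ((x , y) ∷ʳ ps⊆qs) = x ∷ʳ y ∷ʳ flatten⁺ ps⊆qs
flatten⁺ (refl ∷ ps⊆qs)    = refl ∷ refl ∷ flatten⁺ ps⊆qs

Unique-resp-⊆ : ∀ {a} {X : Set a} {xs ys : List X} → ys ⊆ xs → Unique xs → Unique ys
Unique-resp-⊆ []            []         = []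
Unique-resp-⊆ (_ ∷ʳ ys⊆xs)  (_ ∷ xs!)  = Unique-resp-⊆ ys⊆xs xs!
Unique-resp-⊆ (refl ∷ ys⊆xs) (x∉ ∷ xs!) = All-resp-⊆ ys⊆xs x∉ ∷ Unique-resp-⊆ ys⊆xs xs!

module _ (A : List ℕ) where

  BothIn : ℕ × ℕ → Set
  BothIn (x , y) = x ∈ A × y ∈ A

  bothIn? : Decidable BothIn
  bothIn? (x , y) = x ∈? A ×-dec y ∈? A

  length≤bothIn+notIn : ∀ ps →
                        length ps ≤ length (filter bothIn? ps) + length (filter (_∉? A) (flatten ps))
  length≤bothIn+notIn []             = z≤n
  length≤bothIn+notIn ((x , y) ∷ ps) = step (x ∈? A) (y ∈? A)
    where
    |G| |M| : ℕ
    |G| = length (filter bothIn? ps)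
    |M| = length (filter (_∉? A) (flatten ps))
    IH : length ps ≤ |G| + |M|
    IH = length≤bothIn+notIn ps
    Goal : Set
    Goal = length ((x , y) ∷ ps) ≤
           length (filter bothIn? ((x , y) ∷ ps)) + length (filter (_∉? A) (x ∷ y ∷ flatten ps))
    count : ∀ {G M} → filter bothIn? ((x , y) ∷ ps) ≡ G → filter (_∉? A) (x ∷ y ∷ flatten ps) ≡ M →
            length ((x , y) ∷ ps) ≤ length G + length M → Goal
    count refl refl le = le
    reject-∉ : ∀ {z zs} → z ∈ A → filter (_∉? A) (z ∷ zs) ≡ filter (_∉? A) zs
    reject-∉ z∈ = filter-reject (_∉? A) (λ z∉ → z∉ z∈)
    step : Dec (x ∈ A) → Dec (y ∈ A) → Goal
    step (yes x∈) (yes y∈) = count (filter-accept bothIn? {x = x , y} (x∈ , y∈))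
      (trans (reject-∉ x∈) (reject-∉ y∈))
      (s≤s IH)
    step (yes x∈) (no y∉) = count (filter-reject bothIn? {x = x , y} (λ (_ , y∈) → y∉ y∈))
      (trans (reject-∉ x∈) (filter-accept (_∉? A) y∉))
      (≤-trans (s≤s IH) (≤-reflexive (sym (+-suc |G| |M|))))
    step (no x∉) (yes y∈) = count (filter-reject bothIn? {x = x , y} (λ (x∈ , _) → x∉ x∈))
      (trans (filter-accept (_∉? A) x∉) (cong (x ∷_) (reject-∉ y∈)))
      (≤-trans (s≤s IH) (≤-reflexive (sym (+-suc |G| |M|))))
    step (no x∉) (no y∉) = count (filter-reject bothIn? {x = x , y} (λ (x∈ , _) → x∉ x∈))
      (trans (filter-accept (_∉? A) x∉) (cong (x ∷_) (filter-accept (_∉? A) y∉)))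
      (≤-trans (s≤s IH) (≤-trans (≤-reflexive (sym (+-suc |G| |M|))) (+-monoʳ-≤ |G| (n≤1+n (suc |M|)))))

  T+|B|≤bothIn+⌈n/2⌉ : ∀ {n e T} (Q : OddSumPairs n e T) {B} →
                       Unique B → All (OddAtMost n) B → All (_∈ A) B →
                       T + length B ≤ length (filter bothIn? (OddSumPairs.pairs Q)) + ⌈ n /2⌉
  T+|B|≤bothIn+⌈n/2⌉ {n} {T = T} Q {B} B! oddB B⊆A = begin
      T + length B                     ≤⟨ +-monoˡ-≤ (length B) (≤-trans length≥ (length≤bothIn+notIn pairs)) ⟩
      length G + length M + length B   ≡⟨ +-assoc (length G) (length M) (length B) ⟩
      length G + (length M + length B) ≡⟨ cong (λ x → length G + x) (length-++ M) ⟨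
      length G + length (M ++ B)       ≤⟨ +-monoʳ-≤ (length G) |M++B|≤ ⟩
      length G + ⌈ n /2⌉               ∎
    where
    open ≤-Reasoning
    open OddSumPairs Q
    G : List (ℕ × ℕ)
    G = filter bothIn? pairs
    M : List ℕ
    M = filter (_∉? A) (flatten pairs)
    M∩B=∅ : Disjoint M B
    M∩B=∅ (v∈M , v∈B) = All.lookup (All.all-filter (_∉? A) (flatten pairs)) v∈M (All.lookup B⊆A v∈B)
    |M++B|≤ : length (M ++ B) ≤ ⌈ n /2⌉
    |M++B|≤ = length-oddsAtMost≤⌈/2⌉ n (Unique.++⁺ (Unique.filter⁺ (_∉? A) unique) B! M∩B=∅)
                                     (All.++⁺ (All.filter⁺ (_∉? A) oddAtMost) oddB)

  positionPairs : (ps : List (ℕ × ℕ)) → All BothIn ps → List (Fin (length A) × Fin (length A))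
  positionPairs []             []                 = []
  positionPairs ((x , y) ∷ ps) ((x∈A , y∈A) ∷ ins) = (index x∈A , index y∈A) ∷ positionPairs ps ins

  length-positionPairs : ∀ ps ins → length (positionPairs ps ins) ≡ length ps
  length-positionPairs []             []       = refl
  length-positionPairs ((x , y) ∷ ps) (_ ∷ ins) = cong suc (length-positionPairs ps ins)

  map-lookup-positionPairs : ∀ ps ins → map (lookup A) (flatten (positionPairs ps ins)) ≡ flatten ps
  map-lookup-positionPairs []             []                 = refl
  map-lookup-positionPairs ((x , y) ∷ ps) ((x∈A , y∈A) ∷ ins) =
    cong₂ _∷_ (sym (lookup-index x∈A)) (cong₂ _∷_ (sym (lookup-index y∈A)) (map-lookup-positionPairs ps ins))

  positionPairs-formsSum : ∀ {e} (e∈A : e ∈ A) ps ins → All (λ (x , y) → FormsSum e x y) ps →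
                           All (FormsSumAt A (index e∈A)) (positionPairs ps ins)
  positionPairs-formsSum e∈A []             []                 []           = []
  positionPairs-formsSum e∈A ((x , y) ∷ ps) ((x∈A , y∈A) ∷ ins) (sum ∷ sums) =
    subst₂ (FormsSum _) (lookup-index x∈A) (lookup-index y∈A) (subst (λ z → FormsSum z x y) (lookup-index e∈A) sum)
    ∷ positionPairs-formsSum e∈A ps ins sums

  g≤-pairs : ∀ r {e} (e∈A : e ∈ A) (ps : List (ℕ × ℕ)) → All BothIn ps → Unique (e ∷ flatten ps) →
             All (λ (x , y) → FormsSum e x y) ps →
             ∀ D → (∀ a → ∑[ u < r ] ∑[ v < r ] nonRainbow a u v ≤ D) →
             g A r ≤ r ^ (length A ∸ suc (length (flatten ps))) * (r * D ^ length ps)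
  g≤-pairs r {e} e∈A ps ins e∷ps! sums D D-bound =
    subst₂ (λ l k → g A r ≤ r ^ (length A ∸ suc l) * (r * D ^ k)) |flatten| (length-positionPairs ps ins)
      (g≤-indexPairs A r (index e∈A) P P! (positionPairs-formsSum e∈A ps ins sums) D D-bound)
    where
    P : List (Fin (length A) × Fin (length A))
    P = positionPairs ps ins
    lookup-e∷P : map (lookup A) (index e∈A ∷ flatten P) ≡ e ∷ flatten ps
    lookup-e∷P = cong₂ _∷_ (sym (lookup-index e∈A)) (map-lookup-positionPairs ps ins)
    P! : Unique (index e∈A ∷ flatten P)
    P! = Unique.map⁻ (subst Unique (sym lookup-e∷P) e∷ps!)
    |flatten| : length (flatten P) ≡ length (flatten ps)
    |flatten| = trans (sym (length-map (lookup A) (flatten P))) (cong length (map-lookup-positionPairs ps ins))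

length-≤-Unique-⊆ : ∀ {xs ys : List ℕ} → Unique xs → All (_∈ ys) xs → length xs ≤ length ys
length-≤-Unique-⊆ {xs} {ys} xs! xs⊆ys = injective⇒≤ {f = position} position-injective
  where
  position : Fin (length xs) → Fin (length ys)
  position i = index (All.lookup xs⊆ys (∈-lookup i))
  position-injective : ∀ {i j} → position i ≡ position j → i ≡ j
  position-injective {i} {j} eq = lookup-injective xs!
    (trans (lookup-index (All.lookup xs⊆ys (∈-lookup i)))
      (trans (cong (lookup ys) eq) (sym (lookup-index (All.lookup xs⊆ys (∈-lookup j))))))

+/1≡mkℚ : ∀ x → + x / 1 ≡ mkℚ (+ x) 0 (coprime-sym (1-coprimeTo x))
+/1≡mkℚ x = ℚ.normalize-coprime (coprime-sym (1-coprimeTo x))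

≤ε*⇒36*≤ : ∀ {ε} → ε ≤ℚ + 1 / 36 → ∀ x n → + x / 1 ≤ℚ ε *ℚ (+ n / 1) → 36 * x ≤ n
≤ε*⇒36*≤ {ε} ε≤1/36 x n x≤εn =
  from-ℚᵘ (ℚᵘ.≤-respʳ-≃ (ℚ.toℚᵘ-homo-* (+ 1 / 36) (+ n / 1)) (ℚ.toℚᵘ-mono-≤ x≤n/36))
  where
  x≤n/36 : + x / 1 ≤ℚ + 1 / 36 *ℚ (+ n / 1)
  x≤n/36 = ℚ.≤-trans x≤εn (subst (λ q → ε *ℚ q ≤ℚ + 1 / 36 *ℚ q) (sym (+/1≡mkℚ n))
                             (ℚ.*-monoʳ-≤-nonNeg (mkℚ (+ n) 0 (coprime-sym (1-coprimeTo n))) ε≤1/36))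
  from-ℚᵘ : toℚᵘ (+ x / 1) ℚᵘ.≤ toℚᵘ (+ 1 / 36) ℚᵘ.* toℚᵘ (+ n / 1) → 36 * x ≤ n
  from-ℚᵘ x≤n/36ᵘ
    with ℚᵘ.*≤* x*36≤1*n*1 ← subst₂ (λ a b → toℚᵘ a ℚᵘ.≤ toℚᵘ (+ 1 / 36) ℚᵘ.* toℚᵘ b)
                                   (+/1≡mkℚ x) (+/1≡mkℚ n) x≤n/36ᵘ
    = ≤-trans (≤-reflexive (*-comm 36 x)) (ℤ.drop‿+≤+ (subst₂ ℤ._≤_ (sym (ℤ.pos-* x 36)) 1*n*1≡n x*36≤1*n*1))
    where
    1*n*1≡n : (+ 1 ℤ.* + n) ℤ.* + 1 ≡ + n
    1*n*1≡n = trans (ℤ.*-identityʳ _) (ℤ.*-identityˡ (+ n))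

[3r∸2]²≤r³ : ∀ r → 8 ≤ r → (3 * r ∸ 2) ^ 2 ≤ r ^ 3
[3r∸2]²≤r³ r 8≤r = begin
    (3 * r ∸ 2) ^ 2                          ≡⟨ cong (λ x → (3 * x ∸ 2) ^ 2) (sym r≡8+t) ⟩
    (3 * (8 + t) ∸ 2) ^ 2                    ≡⟨ cong (λ x → (x ∸ 2) ^ 2) (split t) ⟩
    (2 + (22 + 3 * t) ∸ 2) ^ 2               ≡⟨ cong (_^ 2) (m+n∸m≡n 2 (22 + 3 * t)) ⟩
    (22 + 3 * t) ^ 2                         ≤⟨ m≤m+n _ (28 + 60 * t + 15 * t * t + t * t * t) ⟩
    (22 + 3 * t) ^ 2 + (28 + 60 * t + 15 * t * t + t * t * t) ≡⟨ expand t ⟩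
    (8 + t) ^ 3                              ≡⟨ cong (_^ 3) r≡8+t ⟩
    r ^ 3                                    ∎
  where
  open ≤-Reasoning
  t : ℕ
  t = r ∸ 8
  r≡8+t : 8 + t ≡ r
  r≡8+t = m+[n∸m]≡n 8≤r
  split : ∀ t → 3 * (8 + t) ≡ 2 + (22 + 3 * t)
  split = solve-∀
  expand : ∀ t → (22 + 3 * t) * ((22 + 3 * t) * 1) + (28 + 60 * t + 15 * t * t + t * t * t)
                 ≡ (8 + t) * ((8 + t) * ((8 + t) * 1))
  expand = solve-∀

r*g<r^h*D : ∀ r D c h m g → 1 < r → 0 < D → D ^ 2 ≤ r ^ 3 →
            let s = suc (suc (c * 2) + suc (c * 2)) in
            s ≤ m → m ≡ h + c → g ≤ r ^ (m ∸ s) * (r * D ^ suc (c * 2)) → r * g < r ^ h * D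
r*g<r^h*D r D c h m g 1<r 0<D D²≤r³ s≤m m≡h+c g≤ = begin-strict
    r * g                                   ≤⟨ *-monoʳ-≤ r g≤ ⟩
    r * (r ^ d * (r * (D * D ^ (c * 2))))   ≡⟨ cong (λ x → r * (r ^ d * (r * (D * x)))) D^2c≡ ⟩
    r * (r ^ d * (r * (D * (D ^ 2) ^ c)))   ≡⟨ regroup r (r ^ d) ((D ^ 2) ^ c) D ⟩
    r ^ (2 + d) * (D ^ 2) ^ c * D           ≤⟨ *-monoˡ-≤ D (*-monoʳ-≤ (r ^ (2 + d)) (^-monoˡ-≤ c D²≤r³)) ⟩
    r ^ (2 + d) * (r ^ 3) ^ c * D           ≡⟨ cong (λ x → r ^ (2 + d) * x * D) (^-*-assoc r 3 c) ⟩
    r ^ (2 + d) * r ^ (3 * c) * D           ≡⟨ cong (_* D) (^-distribˡ-+-* r (2 + d) (3 * c)) ⟨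
    r ^ (2 + d + 3 * c) * D                 <⟨ *-monoˡ-< D (^-monoʳ-< r 1<r (n<1+n (2 + d + 3 * c))) ⟩
    r ^ suc (2 + d + 3 * c) * D             ≡⟨ cong (λ x → r ^ x * D) h≡ ⟩
    r ^ h * D                               ∎
  where
  open ≤-Reasoning
  instance
    D≢0 : NonZero D
    D≢0 = >-nonZero 0<D
  s d : ℕ
  s = suc (suc (c * 2) + suc (c * 2))
  d = m ∸ s
  D^2c≡ : D ^ (c * 2) ≡ (D ^ 2) ^ c
  D^2c≡ = trans (cong (D ^_) (*-comm c 2)) (sym (^-*-assoc D 2 c))
  regroup : ∀ r x y D → r * (x * (r * (D * y))) ≡ r * (r * x) * y * D
  regroup = solve-∀
  d+s : ∀ d c → d + suc (suc (c * 2) + suc (c * 2)) ≡ suc (2 + d + 3 * c) + c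
  d+s = solve-∀
  h≡ : suc (2 + d + 3 * c) ≡ h
  h≡ = +-cancelʳ-≡ c _ h (trans (sym (d+s d c)) (trans (m∸n+n≡m s≤m) m≡h+c))

r*g<r^h*[3r∸2] : ∀ r c h m g → 8 ≤ r → let s = suc (suc (c * 2) + suc (c * 2)) in
                 s ≤ m → m ≡ h + c → g ≤ r ^ (m ∸ s) * (r * (3 * r ∸ 2) ^ suc (c * 2)) →
                 r * g < r ^ h * (3 * r ∸ 2)
r*g<r^h*[3r∸2] r c h m g 8≤r = r*g<r^h*D r (3 * r ∸ 2) c h m g 1<r 0<3r∸2 ([3r∸2]²≤r³ r 8≤r)
  where
  1<r : 1 < r
  1<r = ≤-trans (s≤s (s≤s z≤n)) 8≤r
  0<3r∸2 : 0 < 3 * r ∸ 2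
  0<3r∸2 = m<n⇒0<n∸m (≤-trans (s≤s (s≤s (s≤s z≤n))) (*-monoʳ-≤ 3 (≤-trans (s≤s z≤n) 8≤r)))

record StarPairs (A : List ℕ) (e K : ℕ) : Set where
  field
    centre∈A : e ∈ A
    pairs    : List (ℕ × ℕ)
    length≡  : length pairs ≡ K
    bothIn   : All (BothIn A) pairs
    unique   : Unique (e ∷ flatten pairs)
    formsSum : All (λ (x , y) → FormsSum e x y) pairs

module _ {A e K} (S : StarPairs A e K) where
  open StarPairs S

  private
    |flatten|≡ : length (flatten pairs) ≡ K + K
    |flatten|≡ = trans (length-flatten pairs) (cong₂ _+_ length≡ length≡)

  1+2K≤|A| : suc (K + K) ≤ length A
  1+2K≤|A| = subst (λ l → suc l ≤ length A) |flatten|≡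
               (length-≤-Unique-⊆ unique (centre∈A ∷ All-flatten pairs bothIn))

  g≤-StarPairs : ∀ r → g A r ≤ r ^ (length A ∸ suc (K + K)) * (r * (3 * r ∸ 2) ^ K)
  g≤-StarPairs r = subst₂ (λ l k → g A r ≤ r ^ (length A ∸ suc l) * (r * (3 * r ∸ 2) ^ k)) |flatten|≡ length≡
    (g≤-pairs A r centre∈A pairs bothIn unique formsSum (3 * r ∸ 2) ∑∑nonRainbow≤)

private
  18*[C+c+1]≤ : ∀ C c n → 36 * C ≤ n → 36 * c ≤ n → 18 * (C + c + 1) ≤ n + 18
  18*[C+c+1]≤ C c n 36C≤n 36c≤n = begin
      18 * (C + c + 1)  ≡⟨ *-distribˡ-+ 18 (C + c) 1 ⟩
      18 * (C + c) + 18 ≤⟨ +-monoˡ-≤ 18 (*-cancelˡ-≤ 2 (begin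
        2 * (18 * (C + c)) ≡⟨ regroup C c ⟩
        36 * C + 36 * c    ≤⟨ +-mono-≤ 36C≤n 36c≤n ⟩
        n + n              ≡⟨ cong (λ x → n + x) (+-identityʳ n) ⟨
        2 * n              ∎)) ⟩
      n + 18            ∎
    where
    open ≤-Reasoning
    regroup : ∀ C c → 2 * (18 * (C + c)) ≡ 36 * C + 36 * c
    regroup = solve-∀

  1+2c≤ : ∀ {|B| |C| |G| h c} → |C| + c + 1 + |B| ≤ |G| + h → |B| + |C| ≡ h + c → suc (c * 2) ≤ |G|
  1+2c≤ {|B|} {|C|} {|G|} {h} {c} T+|B|≤ |B|+|C|≡ = +-cancelʳ-≤ h _ _ (begin
      suc (c * 2) + h        ≡⟨ regroup c h ⟩
      h + c + c + 1          ≡⟨ cong (λ x → x + c + 1) |B|+|C|≡ ⟨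
      |B| + |C| + c + 1      ≡⟨ regroup′ |B| |C| c ⟩
      |C| + c + 1 + |B|      ≤⟨ T+|B|≤ ⟩
      |G| + h                ∎)
    where
    open ≤-Reasoning
    regroup : ∀ c h → suc (c * 2) + h ≡ h + c + c + 1
    regroup = solve-∀
    regroup′ : ∀ b C c → b + C + c + 1 ≡ C + c + 1 + b
    regroup′ = solve-∀

starPairs : ∀ n {A : List ℕ} {e} → e ∈ A → ¬ Odd e → 1 ≤ e → e ≤ n →
            ∀ {B C : List ℕ} {c} → Unique B → All (OddAtMost n) B → All (_∈ A) B →
            length B + length C ≡ ⌈ n /2⌉ + c →
            2 ≤ c → 36 * c ≤ n → 36 * length C ≤ n → StarPairs A e (suc (c * 2))
starPairs n {A} {e} e∈A ¬odd 1≤e e≤n {B} {C} {c} B! oddB B⊆A |B|+|C|≡ 2≤c 36c≤n 36C≤n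
  with q , refl ← ¬odd⇒even {e} ¬odd = record
  { centre∈A = e∈A
  ; pairs    = take K G
  ; length≡  = trans (length-take K G) (m≤n⇒m⊓n≡m K≤|G|)
  ; bothIn   = All.take⁺ K (All.all-filter (bothIn? A) pairs)
  ; unique   = e∉pairs ∷ Unique-resp-⊆ (flatten⁺ ⊆Q) unique
  ; formsSum = All-resp-⊆ ⊆Q formsSum
  }
  where
  K T : ℕ
  K = suc (c * 2)
  T = length C + c + 1
  positive : ∀ q → 1 ≤ q * 2 → 1 ≤ q
  positive (suc _) _ = s≤s z≤n
  Q : OddSumPairs n (q * 2) T
  Q = oddSumPairs n q T (positive q 1≤e) e≤n (≤-trans (*-monoʳ-≤ 36 2≤c) 36c≤n)
        (18*[C+c+1]≤ (length C) c n 36C≤n 36c≤n)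
  open OddSumPairs Q
  G : List (ℕ × ℕ)
  G = filter (bothIn? A) pairs
  K≤|G| : K ≤ length G
  K≤|G| = 1+2c≤ {|B| = length B} {|C| = length C} (T+|B|≤bothIn+⌈n/2⌉ A Q B! oddB B⊆A) |B|+|C|≡
  ⊆Q : take K G ⊆ pairs
  ⊆Q = ⊆-trans (take-⊆ K G) (filter-⊆ (bothIn? A) pairs)
  e∉pairs : All (q * 2 ≢_) (flatten (take K G))
  e∉pairs = All.map (λ (odd , _) e≡ → ¬odd (subst Odd (sym e≡) odd)) (All-resp-⊆ (flatten⁺ ⊆Q) oddAtMost)

∃-even-∈ : ∀ n {A : List ℕ} → Unique A → All (_≤ n) A → ⌈ n /2⌉ < length A → ∃[ e ] e ∈ A × ¬ Odd e
∃-even-∈ n {A} A! A≤n ⌈n/2⌉<|A| = find (All.¬All⇒Any¬ (λ x → x % 2 ≟ 1) A ¬allOdd)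
  where
  ¬allOdd : ¬ All Odd A
  ¬allOdd odds = <⇒≱ ⌈n/2⌉<|A| (length-oddsAtMost≤⌈/2⌉ n A! (All.zip (odds , A≤n)))

mainTheorem18 :
    (r : ℕ) → 8 ≤ r →
    (ε : ℚ) → 0ℚ <ℚ ε → ε ≤ℚ (+ 1 / 36) →
    (n : ℕ) → 1 ≤ n →
    (A : List ℕ) → Unique A → All (λ a → 1 ≤ a × a ≤ n) A →
    (c : ℕ) → length A ≡ ⌈ n /2⌉ + c → 1 < c → (+ c / 1) ≤ℚ ε *ℚ (+ n / 1) →
    (B C : List ℕ) → A ↭ B ++ C → All Odd B → (+ length C / 1) ≤ℚ ε *ℚ (+ n / 1) →
    r * g A r < r ^ ⌈ n /2⌉ * (3 * r ∸ 2)
mainTheorem18 r 8≤r ε _ ε≤1/36 n _ A A! A⊆[1,n] c |A|≡ 1<c c≤εn B C A↭B++C oddB |C|≤εn =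
  r*g<r^h*[3r∸2] r c ⌈ n /2⌉ (length A) (g A r) 8≤r (1+2K≤|A| S) |A|≡ (g≤-StarPairs S r)
  where
  inRange : ∀ {a} → a ∈ A → 1 ≤ a × a ≤ n
  inRange = All.lookup A⊆[1,n]
  B⊆A : All (_∈ A) B
  B⊆A = All.tabulate (λ x∈B → ∈-resp-↭ (↭-sym A↭B++C) (∈-++⁺ˡ x∈B))
  B! : Unique B
  B! = Unique-resp-⊆ (++⁺ʳ C ⊆-refl) (Permutationₛ.Unique-resp-↭ (setoid ℕ) (↭⇒↭ₛ A↭B++C) A!)
  |B|+|C|≡ : length B + length C ≡ ⌈ n /2⌉ + c
  |B|+|C|≡ = trans (sym (length-++ B)) (trans (sym (↭-length A↭B++C)) |A|≡)
  even : ∃[ e ] e ∈ A × ¬ Odd e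
  even = ∃-even-∈ n A! (All.map proj₂ A⊆[1,n]) (subst (⌈ n /2⌉ <_) (sym |A|≡) (m<m+n _ (<-trans (s≤s z≤n) 1<c)))
  e∈A : proj₁ even ∈ A
  e∈A = proj₁ (proj₂ even)
  S : StarPairs A (proj₁ even) (suc (c * 2))
  S = starPairs n e∈A (proj₂ (proj₂ even)) (proj₁ (inRange e∈A)) (proj₂ (inRange e∈A))
        {B} {C} B! (All.zip (oddB , All.map (proj₂ ∘ inRange) B⊆A)) B⊆A |B|+|C|≡ 1<c
        (≤ε*⇒36*≤ ε≤1/36 c n c≤εn) (≤ε*⇒36*≤ ε≤1/36 (length C) n |C|≤εn)
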